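{- Let $P$ be a slant irreducible $\Gamma$-colored $d$-complete poset (in particular finite) and assume $\Gamma$ is simply laced. If the top tree $T$ contains more than one element, then there exists a unique element of $T$ that covers more than one element of $T$. This element covers exactly two elements of $T$ and is comparable to every element of $T$.
   Context: Dynkin diagram $\Gamma$: finite set with integers $\theta_{ab}$, $\theta_{aa}=2$, $\theta_{ab}\le0$ ($a\ne b$), $\theta_{ab}=0\iff\theta_{ba}=0$; $a\sim b$ if $a\ne b$ and $\theta_{ab}<0$; simply laced: all $\theta_{ab}\in\{ -1,0,2\}$. $\Gamma$-colored poset: poset with surjective $\kappa:P\to\Gamma$. Consecutive elements of color $a$: $x<y$ of color $a$, no color-$a$ element in $(x,y)$. $U(x,P)=\{y>x:\kappa(y)\sim\kappa(x)\}$. $\Gamma$-colored $d$-complete: locally finite with (EC) equal colors comparable; (NA) neighbors (one covers the other) have adjacent colors; (AC) adjacent colors comparable; (ICE2) consecutive $x<y$ of color $a$ have $\sum_{z\in(x,y)}-\theta_{\kappa(z),a}=2$; (UCB1) for maximal $x$ of color $a$, $U(x,P)$ finite and $\sum_{y\in U(x,P)}-\theta_{\kappa(y),a}\le1$. For finite $P$, the top tree $T$ is the set of elements maximal among elements of their color. A finite $\Gamma$-colored $d$-complete $P$ is slant irreducible if connected and whenever $x,y\in T$ with $y$ covering $x$, $y$ is not the only element of its color in $P$. -}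

module Defs where

open import Data.Nat using (ℕ)
open import Data.Fin using (Fin)
open import Data.Fin.Properties using (_≟_)
open import Data.Integer using (ℤ; +_; -_; _+_; _<_; _≤_; -1ℤ; 0ℤ)
open import Data.Integer.Properties using (_<?_) renaming (_≟_ to _≟ℤ_)
open import Data.List using (List; foldr; map; filter; allFin)
open import Data.Product using (Σ; _×_; _,_; ∃; ∃-syntax)
open import Data.Sum using (_⊎_)
open import Relation.Nullary using (¬_; Dec; yes; no)
open import Relation.Nullary.Decidable using (_×-dec_; ¬?)
open import Relation.Unary using (Pred)
open import Relation.Binary using (Rel; Decidable; IsPartialOrder)
open import Relation.Binary.PropositionalEquality using (_≡_; _≢_)
open import Relation.Binary.Construct.Closure.ReflexiveTransitive using (Star)

sumℤ : List ℤ → ℤ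
sumℤ = foldr _+_ 0ℤ

-- A Dynkin diagram on the finite vertex set Fin m (a Cartan-type matrix θ).
record Dynkin (m : ℕ) : Set where
  field
    θ        : Fin m → Fin m → ℤ
    diag     : ∀ a → θ a a ≡ + 2
    offdiag  : ∀ a b → a ≢ b → θ a b ≤ 0ℤ
    zero-sym : ∀ a b → θ a b ≡ 0ℤ → θ b a ≡ 0ℤ

  Adj : Fin m → Fin m → Set
  Adj a b = a ≢ b × θ a b < 0ℤ

  adj? : ∀ a b → Dec (Adj a b)
  adj? a b = ¬? (a ≟ b) ×-dec (θ a b <? 0ℤ)

open Dynkin public

SimplyLaced : ∀ {m} → Dynkin m → Set
SimplyLaced {m} Γ = ∀ (a b : Fin m) → θ Γ a b ≡ -1ℤ ⊎ θ Γ a b ≡ 0ℤ ⊎ θ Γ a b ≡ + 2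

record ColoredPoset {m : ℕ} (Γ : Dynkin m) (n : ℕ) : Set₁ where
  field
    _⊑_       : Rel (Fin n) _
    isPO      : IsPartialOrder _≡_ _⊑_
    _⊑?_      : Decidable _⊑_
    κ         : Fin n → Fin m
    surj      : ∀ (a : Fin m) → ∃[ x ] κ x ≡ a

  _⊏_ : Fin n → Fin n → Set
  x ⊏ y = x ⊑ y × x ≢ y

  _⊏?_ : Decidable _⊏_
  x ⊏? y = (x ⊑? y) ×-dec ¬? (x ≟ y)

  Comparable : Fin n → Fin n → Set
  Comparable x y = x ⊑ y ⊎ y ⊑ x

  Covers : Fin n → Fin n → Set
  Covers y x = x ⊏ y × (∀ z → ¬ (x ⊏ z × z ⊏ y))

  Consecutive : Fin m → Fin n → Fin n → Set
  Consecutive a x y = x ⊏ y × κ x ≡ a × κ y ≡ a × (∀ z → x ⊏ z → z ⊏ y → κ z ≢ a)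

  intervalSum : Fin m → Fin n → Fin n → ℤ
  intervalSum a x y =
    sumℤ (map (λ z → - θ Γ (κ z) a)
              (filter (λ z → (x ⊏? z) ×-dec (z ⊏? y)) (allFin n)))

  MaxOfColor : Fin n → Set
  MaxOfColor x = ∀ y → κ y ≡ κ x → ¬ (x ⊏ y)

  upperSum : Fin n → ℤ
  upperSum x =
    sumℤ (map (λ y → - θ Γ (κ y) (κ x))
              (filter (λ y → (x ⊏? y) ×-dec adj? Γ (κ y) (κ x)) (allFin n)))

  InTop : Fin n → Set
  InTop = MaxOfColor

  -- connectedness (of the comparability graph, equivalently the Hasse diagram)
  Connected : Set
  Connected = ∀ x y → Star Comparable x y

open ColoredPoset public

-- Γ-colored d-complete (finite, so locally finite automatically and U(x,P) finite).
record DComplete {m n : ℕ} {Γ : Dynkin m} (P : ColoredPoset Γ n) : Set where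
  field
    EC   : ∀ x y → κ P x ≡ κ P y → Comparable P x y
    NA   : ∀ x y → Covers P y x → Adj Γ (κ P x) (κ P y)
    AC   : ∀ x y → Adj Γ (κ P x) (κ P y) → Comparable P x y
    ICE2 : ∀ a x y → Consecutive P a x y → intervalSum P a x y ≡ + 2
    UCB1 : ∀ x → MaxOfColor P x → upperSum P x ≤ + 1

SlantIrreducible : ∀ {m n} {Γ : Dynkin m} → ColoredPoset Γ n → Set
SlantIrreducible {n = n} P =
  Connected P ×
  (∀ x y → InTop P x → InTop P y → Covers P y x →
     ∃[ z ] (z ≢ y × κ P z ≡ κ P y))

-- In the simply laced case (UCB1) says that an element x of the top tree T has at most one
-- element above it whose color is adjacent to that of x; hence T is an up-set, every element of T
-- has a unique upper cover, and the elements above it form a chain.  (ICE2) says that between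
-- consecutive elements s < x of one color there are exactly two elements whose colors are
-- adjacent to that of x.  Start from a maximal element r: connectedness puts all of T below r, and
-- slant irreducibility gives an s below r of its color.  Of the two adjacent-colored elements in
-- (s, r), either both lie in T, and then r covers exactly these two elements of T, or one is the
-- top of the other's color, and it is then the only element of T covered by r, so we descend to
-- it.  Below the fork every element of T covers at most one element of T, since the interval
-- attached to it already contains the element s of the previous step.
module Submission where

open import Defs
open import Data.Nat using (ℕ; zero; suc; z≤n; s≤s)
open import Data.Fin using (Fin; zero; suc)
open import Data.Fin.Properties using (_≟_; any?)
open import Data.Fin.Induction using (po-wellFounded; po-noetherian)
open import Data.Integer using (ℤ; +_; -_; _+_; _≤_; -1ℤ; 0ℤ; 1ℤ; +≤+)
import Data.Integer.Properties as ℤ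
open import Algebra.Properties.CommutativeMonoid.Sum ℤ.+-0-commutativeMonoid
  using (sum; ∑-distrib-+; sum-cong-≗; sum-replicate-zero)
open import Data.List using (map; filter; tabulate)
open import Data.Product using (_×_; _,_; ∃; ∃-syntax; proj₁; proj₂)
open import Data.Sum using (_⊎_; inj₁; inj₂; swap)
open import Data.Empty using (⊥; ⊥-elim)
open import Data.Unit using (⊤; tt)
open import Function using (_∘_; id; flip)
open import Relation.Nullary using (¬_; Dec; yes; no)
open import Relation.Nullary.Decidable using (_×-dec_; ¬?)
open import Relation.Unary using (Pred) renaming (Decidable to Decidable₁)
open import Relation.Binary using (Rel; Decidable; IsPartialOrder)
open import Relation.Binary.PropositionalEquality
open import Relation.Binary.Construct.Closure.ReflexiveTransitive using (Star; ε; _◅_; fold)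
import Relation.Binary.Construct.NonStrictToStrict as Strict
open import Induction.WellFounded using (Acc; acc)

guard : ∀ {p} {A : Set p} → Dec A → ℤ → ℤ
guard (yes _) v = v
guard (no _)  _ = 0ℤ

indicator : ∀ {k} → Fin k → Fin k → ℤ
indicator a i = guard (i ≟ a) 1ℤ

sum-filter : ∀ {n k q} {Q : Pred (Fin n) q} (Q? : Decidable₁ Q) (g : Fin n → ℤ) (h : Fin k → Fin n) →
             sumℤ (map g (filter Q? (tabulate h))) ≡ sum (λ i → guard (Q? (h i)) (g (h i)))
sum-filter {k = zero}  Q? g h = refl
sum-filter {k = suc k} Q? g h with Q? (h zero)
... | yes _ = cong (λ t → g (h zero) + t) (sum-filter Q? g (h ∘ suc))
... | no  _ = trans (sum-filter Q? g (h ∘ suc)) (sym (ℤ.+-identityˡ _))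

sum-mono-≤ : ∀ {k} {f g : Fin k → ℤ} → (∀ i → f i ≤ g i) → sum f ≤ sum g
sum-mono-≤ {zero}  f≤g = ℤ.≤-refl
sum-mono-≤ {suc k} f≤g = ℤ.+-mono-≤ (f≤g zero) (sum-mono-≤ (f≤g ∘ suc))

sum-indicator : ∀ {k} (a : Fin k) → sum (indicator a) ≡ 1ℤ
sum-indicator {suc k} zero    = cong (λ t → 1ℤ + t) (sum-replicate-zero k)
sum-indicator {suc k} (suc a) = trans (ℤ.+-identityˡ _) (trans (sum-cong-≗ shift) (sum-indicator a))
  where
    shift : ∀ i → indicator (suc a) (suc i) ≡ indicator a i
    shift i with i ≟ a
    ... | yes _ = refl
    ... | no  _ = refl

sum-two-indicators : ∀ {k} (a b : Fin k) → sum (λ i → indicator a i + indicator b i) ≡ + 2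
sum-two-indicators a b =
  trans (∑-distrib-+ (indicator a) (indicator b)) (cong₂ _+_ (sum-indicator a) (sum-indicator b))

module _ {k} {f : Fin k → ℤ} where

  sum-≤0 : (∀ i → f i ≤ 0ℤ) → sum f ≤ 0ℤ
  sum-≤0 f≤0 = ℤ.≤-trans (sum-mono-≤ f≤0) (ℤ.≤-reflexive (sum-replicate-zero k))

  sum-≤1 : ∀ {a} → f a ≤ 1ℤ → (∀ i → i ≢ a → f i ≤ 0ℤ) → sum f ≤ 1ℤ
  sum-≤1 {a} fa≤1 f≤0 = ℤ.≤-trans (sum-mono-≤ f≤indicator) (ℤ.≤-reflexive (sum-indicator a))
    where
      f≤indicator : ∀ i → f i ≤ indicator a i
      f≤indicator i with i ≟ a
      ... | yes refl = fa≤1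
      ... | no  i≢a  = f≤0 i i≢a

  2≤sum : ∀ {a b} → (∀ i → 0ℤ ≤ f i) → a ≢ b → 1ℤ ≤ f a → 1ℤ ≤ f b → + 2 ≤ sum f
  2≤sum {a} {b} 0≤f a≢b 1≤fa 1≤fb = subst (_≤ sum f) (sum-two-indicators a b) (sum-mono-≤ pointwise)
    where
      pointwise : ∀ i → indicator a i + indicator b i ≤ f i
      pointwise i with i ≟ a | i ≟ b
      ... | yes refl | yes refl = ⊥-elim (a≢b refl)
      ... | yes refl | no  _    = 1≤fa
      ... | no  _    | yes refl = 1≤fb
      ... | no  _    | no  _    = 0≤f i

  3≤sum : ∀ {a b c} → (∀ i → 0ℤ ≤ f i) → a ≢ b → a ≢ c → b ≢ c →
          1ℤ ≤ f a → 1ℤ ≤ f b → 1ℤ ≤ f c → + 3 ≤ sum f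
  3≤sum {a} {b} {c} 0≤f a≢b a≢c b≢c 1≤fa 1≤fb 1≤fc = subst (_≤ sum f) sum-three (sum-mono-≤ pointwise)
    where
      sum-three : sum (λ i → indicator a i + indicator b i + indicator c i) ≡ + 3
      sum-three = trans (∑-distrib-+ (λ i → indicator a i + indicator b i) (indicator c))
                        (cong₂ _+_ (sum-two-indicators a b) (sum-indicator c))

      pointwise : ∀ i → indicator a i + indicator b i + indicator c i ≤ f i
      pointwise i with i ≟ a | i ≟ b | i ≟ c
      ... | yes refl | yes refl | _        = ⊥-elim (a≢b refl)
      ... | yes refl | _        | yes refl = ⊥-elim (a≢c refl)
      ... | _        | yes refl | yes refl = ⊥-elim (b≢c refl)
      ... | yes refl | no  _    | no  _    = 1≤fa
      ... | no  _    | yes refl | no  _    = 1≤fb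
      ... | no  _    | no  _    | yes refl = 1≤fc
      ... | no  _    | no  _    | no  _    = 0≤f i

2≰0 : ¬ (+ 2 ≤ 0ℤ)
2≰0 (+≤+ ())

2≰1 : ¬ (+ 2 ≤ 1ℤ)
2≰1 (+≤+ (s≤s ()))

3≰2 : ¬ (+ 3 ≤ + 2)
3≰2 (+≤+ (s≤s (s≤s ())))

module _ {m} (Γ : Dynkin m) where

  Adj-sym : ∀ {a b} → Adj Γ a b → Adj Γ b a
  Adj-sym {a} {b} (a≢b , θab<0) =
    b≢a , ℤ.≤∧≢⇒< (offdiag Γ b a b≢a) (λ θba≡0 → ℤ.<⇒≢ θab<0 (zero-sym Γ b a θba≡0))
    where
      b≢a : b ≢ a
      b≢a = a≢b ∘ sym

  non-adjacent⇒θ≡0 : ∀ {a b} → a ≢ b → ¬ Adj Γ a b → θ Γ a b ≡ 0ℤ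
  non-adjacent⇒θ≡0 {a} {b} a≢b ¬adj =
    ℤ.≤-antisym (offdiag Γ a b a≢b) (ℤ.≮⇒≥ (λ θab<0 → ¬adj (a≢b , θab<0)))

  adjacent⇒θ≡-1 : SimplyLaced Γ → ∀ {a b} → Adj Γ a b → θ Γ a b ≡ -1ℤ
  adjacent⇒θ≡-1 simply-laced {a} {b} (_ , θab<0) with simply-laced a b
  ... | inj₁ θab≡-1        = θab≡-1
  ... | inj₂ (inj₁ θab≡0)  = ⊥-elim (ℤ.<⇒≢ θab<0 θab≡0)
  ... | inj₂ (inj₂ θab≡2)  = ⊥-elim (ℤ.<⇒≱ θab<0 (subst (0ℤ ≤_) (sym θab≡2) (+≤+ z≤n)))

module _ {n r} {_⊰_ : Rel (Fin n) r} (_⊰?_ : Decidable _⊰_) where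

  maximal-reachable : ∀ {q} {Q : Pred (Fin n) q} → Decidable₁ Q → ∀ {x} → Acc (flip _⊰_) x → Q x →
                      ∃[ e ] (Star _⊰_ x e × Q e × ∀ y → Q y → ¬ e ⊰ y)
  maximal-reachable Q? {x} (acc rs) qx with any? (λ y → Q? y ×-dec x ⊰? y)
  ... | yes (y , qy , x⊰y) =
    let e , y⊰*e , qe , e-max = maximal-reachable Q? (rs x⊰y) qy in e , x⊰y ◅ y⊰*e , qe , e-max
  ... | no  none = x , ε , qx , λ y qy x⊰y → none (y , qy , x⊰y)

module FinitePoset {m n} {Γ : Dynkin m} (P : ColoredPoset Γ n) where

  open ColoredPoset P public using ()
    renaming (_⊑_ to _≼_; _⊏_ to _≺_; _⊏?_ to _≺?_; κ to col)
  open IsPartialOrder (isPO P) public using ()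
    renaming (refl to ≼-refl; reflexive to ≼-reflexive; trans to ≼-trans; antisym to ≼-antisym)

  ≺-trans : ∀ {x y z} → x ≺ y → y ≺ z → x ≺ z
  ≺-trans = Strict.<-trans _≡_ _≼_ (isPO P)

  ≺-≼-trans : ∀ {x y z} → x ≺ y → y ≼ z → x ≺ z
  ≺-≼-trans = Strict.<-≤-trans _≡_ _≼_ sym ≼-trans ≼-antisym (λ { refl y≼z → y≼z })

  ≼-≺-trans : ∀ {x y z} → x ≼ y → y ≺ z → x ≺ z
  ≼-≺-trans = Strict.≤-<-trans _≡_ _≼_ ≼-trans ≼-antisym (λ { refl x≼y → x≼y })

  ≼⇒≡⊎≺ : ∀ {x y} → x ≼ y → x ≡ y ⊎ x ≺ y
  ≼⇒≡⊎≺ {x} {y} x≼y with x ≟ y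
  ... | yes x≡y = inj₁ x≡y
  ... | no  x≢y = inj₂ (x≼y , x≢y)

  comparable-≢ : ∀ {x y} → Comparable P x y → x ≢ y → x ≺ y ⊎ y ≺ x
  comparable-≢ (inj₁ x≼y) x≢y = inj₁ (x≼y , x≢y)
  comparable-≢ (inj₂ y≼x) x≢y = inj₂ (y≼x , x≢y ∘ sym)

  maximal-≼⇒≡ : ∀ {r y} → (∀ z → ¬ r ≺ z) → r ≼ y → r ≡ y
  maximal-≼⇒≡ r-max r≼y with ≼⇒≡⊎≺ r≼y
  ... | inj₁ r≡y = r≡y
  ... | inj₂ r≺y = ⊥-elim (r-max _ r≺y)

  maximal-above : ∀ {q} {Q : Pred (Fin n) q} → Decidable₁ Q → ∀ {x} → Q x →
                  ∃[ e ] (x ≼ e × Q e × ∀ y → Q y → ¬ e ≺ y)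
  maximal-above Q? {x} qx with maximal-reachable _≺?_ Q? (po-noetherian (isPO P) x) qx
  ... | e , x≺*e , qe , e-max = e , fold _≼_ (≼-trans ∘ proj₁) ≼-refl x≺*e , qe , e-max

  minimal-below : ∀ {q} {Q : Pred (Fin n) q} → Decidable₁ Q → ∀ {x} → Q x →
                  ∃[ e ] (e ≼ x × Q e × ∀ y → Q y → ¬ y ≺ e)
  minimal-below Q? {x} qx with maximal-reachable (flip _≺?_) Q? (po-wellFounded (isPO P) x) qx
  ... | e , x≻*e , qe , e-min =
    e , fold (flip _≼_) (λ y≺x z≼y → ≼-trans z≼y (proj₁ y≺x)) ≼-refl x≻*e , qe , e-min

  maximal-element : Fin n → ∃[ r ] ∀ y → ¬ r ≺ y
  maximal-element x with maximal-above {Q = λ _ → ⊤} (λ _ → yes tt) {x} tt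
  ... | r , _ , _ , r-max = r , λ y → r-max y tt

  maximal⇒InTop : ∀ {r} → (∀ y → ¬ r ≺ y) → InTop P r
  maximal⇒InTop r-max y _ = r-max y

  top-of-color : ∀ a → ∃[ t ] (col t ≡ a × InTop P t)
  top-of-color a with surj P a
  ... | x , x∈a with maximal-above (λ y → col y ≟ a) x∈a
  ...   | t , _ , t∈a , t-max = t , t∈a , λ y y∈t → t-max y (trans y∈t t∈a)

  previous-of-color : ∀ {a y w} → col y ≡ a → w ≺ y → col w ≡ a →
                      ∃[ s ] (Consecutive P a s y × w ≼ s)
  previous-of-color {a} {y} y∈a w≺y w∈a
    with maximal-above (λ z → (z ≺? y) ×-dec (col z ≟ a)) (w≺y , w∈a)
  ... | s , w≼s , (s≺y , s∈a) , s-max =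
    s , (s≺y , s∈a , y∈a , λ z s≺z z≺y z∈a → s-max z (z≺y , z∈a) s≺z) , w≼s

  cover-above : ∀ {x y} → x ≺ y → ∃[ z ] (Covers P z x × z ≼ y)
  cover-above {x} x≺y with minimal-below (x ≺?_) x≺y
  ... | z , z≼y , x≺z , z-min = z , (x≺z , λ w (x≺w , w≺z) → z-min w x≺w w≺z) , z≼y

  cover-below : ∀ {x y} → x ≺ y → ∃[ z ] (x ≼ z × Covers P y z)
  cover-below {y = y} x≺y with maximal-above (_≺? y) x≺y
  ... | z , x≼z , z≺y , z-max = z , x≼z , (z≺y , λ w (z≺w , w≺y) → z-max w w≺y z≺w)

  ≼-by-covers : ∀ {q} (Q : Pred (Fin n) q) → (∀ {a b} → Covers P b a → Q a → Q b) →
                ∀ {a b} → a ≼ b → Q a → Q b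
  ≼-by-covers Q step {a} a≼b = go (po-noetherian (isPO P) a) a≼b
    where
      go : ∀ {a b} → Acc (flip _≺_) a → a ≼ b → Q a → Q b
      go (acc rs) a≼b qa with ≼⇒≡⊎≺ a≼b
      ... | inj₁ refl = qa
      ... | inj₂ a≺b with cover-above a≺b
      ...   | c , c-covers-a , c≼b = go (rs (proj₁ c-covers-a)) c≼b (step c-covers-a qa)

module SimplyLacedDComplete {m n} {Γ : Dynkin m} (simply-laced : SimplyLaced Γ)
                           {P : ColoredPoset Γ n} (dc : DComplete P) where

  open DComplete dc
  open FinitePoset P public

  adjacent-weight : ∀ {a b} → Adj Γ a b → - θ Γ a b ≡ 1ℤ
  adjacent-weight adj = cong -_ (adjacent⇒θ≡-1 Γ simply-laced adj)

  non-adjacent-weight : ∀ {a b} → a ≢ b → ¬ Adj Γ a b → - θ Γ a b ≡ 0ℤ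
  non-adjacent-weight a≢b ¬adj = cong -_ (non-adjacent⇒θ≡0 Γ a≢b ¬adj)

  adjacent-colors⇒≢ : ∀ {x y} → Adj Γ (col x) (col y) → x ≢ y
  adjacent-colors⇒≢ (col-x≢col-y , _) refl = col-x≢col-y refl

  ≼-InTop : ∀ {z t} → InTop P t → col z ≡ col t → z ≼ t
  ≼-InTop {z} {t} t-top z∈t with EC z t z∈t
  ... | inj₁ z≼t = z≼t
  ... | inj₂ t≼z with ≼⇒≡⊎≺ t≼z
  ...   | inj₁ refl = ≼-refl
  ...   | inj₂ t≺z  = ⊥-elim (t-top z z∈t t≺z)

  InTop-unique : ∀ {x y} → InTop P x → InTop P y → col x ≡ col y → x ≡ y
  InTop-unique x-top y-top x∈y = ≼-antisym (≼-InTop y-top x∈y) (≼-InTop x-top (sym x∈y))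

  top : Fin m → Fin n
  top a = proj₁ (top-of-color a)

  top-col : ∀ a → col (top a) ≡ a
  top-col a = proj₁ (proj₂ (top-of-color a))

  top-InTop : ∀ a → InTop P (top a)
  top-InTop a = proj₂ (proj₂ (top-of-color a))

  top-of-InTop : ∀ {x} → InTop P x → top (col x) ≡ x
  top-of-InTop x-top = InTop-unique (top-InTop _) x-top (top-col _)

  top-Adj : ∀ {a c} → Adj Γ a c → Adj Γ (col (top a)) c
  top-Adj = subst (λ d → Adj Γ d _) (sym (top-col _))

  upperTerm : Fin n → Fin n → ℤ
  upperTerm x y = guard ((x ≺? y) ×-dec adj? Γ (col y) (col x)) (- θ Γ (col y) (col x))

  upperSum-as-sum : ∀ x → upperSum P x ≡ sum (upperTerm x)
  upperSum-as-sum x =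
    sum-filter {n = n} (λ y → (x ≺? y) ×-dec adj? Γ (col y) (col x)) (λ y → - θ Γ (col y) (col x)) id

  upper-term-nonneg : ∀ x y → 0ℤ ≤ upperTerm x y
  upper-term-nonneg x y with (x ≺? y) ×-dec adj? Γ (col y) (col x)
  ... | yes (_ , adj) = ℤ.≤-trans (+≤+ z≤n) (ℤ.≤-reflexive (sym (adjacent-weight adj)))
  ... | no  _         = ℤ.≤-refl

  upper-term-neighbour : ∀ {x y} → x ≺ y → Adj Γ (col y) (col x) → upperTerm x y ≡ 1ℤ
  upper-term-neighbour {x} {y} x≺y adj with (x ≺? y) ×-dec adj? Γ (col y) (col x)
  ... | yes (_ , adj′) = adjacent-weight adj′
  ... | no  ¬both      = ⊥-elim (¬both (x≺y , adj))

  -- Each element above x of adjacent color contributes 1 to upperSum, which (UCB1) bounds by 1.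
  upper-neighbour-unique : ∀ {x y₁ y₂} → InTop P x → x ≺ y₁ → Adj Γ (col y₁) (col x) →
                           x ≺ y₂ → Adj Γ (col y₂) (col x) → y₁ ≡ y₂
  upper-neighbour-unique {x} {y₁} {y₂} x-top x≺y₁ adj₁ x≺y₂ adj₂ with y₁ ≟ y₂
  ... | yes y₁≡y₂ = y₁≡y₂
  ... | no  y₁≢y₂ = ⊥-elim (2≰1 (begin
    + 2                ≤⟨ 2≤sum (upper-term-nonneg x) y₁≢y₂ (one x≺y₁ adj₁) (one x≺y₂ adj₂) ⟩
    sum (upperTerm x)  ≡⟨ upperSum-as-sum x ⟨
    upperSum P x       ≤⟨ UCB1 x x-top ⟩
    + 1                ∎))
    where
      open ℤ.≤-Reasoning
      one : ∀ {y} → x ≺ y → Adj Γ (col y) (col x) → 1ℤ ≤ upperTerm x y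
      one x≺y adj = ℤ.≤-reflexive (sym (upper-term-neighbour x≺y adj))

  PrevOfColor : Fin n → Fin n → Set
  PrevOfColor s x = Consecutive P (col x) s x

  AdjInInterval : Fin n → Fin n → Fin n → Set
  AdjInInterval s x z = s ≺ z × z ≺ x × Adj Γ (col z) (col x)

  adjInInterval? : ∀ s x z → Dec (AdjInInterval s x z)
  adjInInterval? s x z = (s ≺? z) ×-dec (z ≺? x) ×-dec adj? Γ (col z) (col x)

  intervalTerm : Fin n → Fin n → Fin n → ℤ
  intervalTerm s x z = guard ((s ≺? z) ×-dec (z ≺? x)) (- θ Γ (col z) (col x))

  interval-total : ∀ {s x} → PrevOfColor s x → sum (intervalTerm s x) ≡ + 2
  interval-total {s} {x} s-prev = begin
    sum (intervalTerm s x)    ≡⟨ sum-filter {n = n} (λ z → (s ≺? z) ×-dec (z ≺? x))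
                                                     (λ z → - θ Γ (col z) (col x)) id ⟨
    intervalSum P (col x) s x ≡⟨ ICE2 (col x) s x s-prev ⟩
    + 2                       ∎
    where open ≡-Reasoning

  interval-term-adjacent : ∀ {s x z} → AdjInInterval s x z → intervalTerm s x z ≡ 1ℤ
  interval-term-adjacent {s} {x} {z} (s≺z , z≺x , adj) with (s ≺? z) ×-dec (z ≺? x)
  ... | yes _    = adjacent-weight adj
  ... | no ¬both = ⊥-elim (¬both (s≺z , z≺x))

  interval-term-non-adjacent : ∀ {s x z} → PrevOfColor s x → ¬ AdjInInterval s x z →
                               intervalTerm s x z ≡ 0ℤ
  interval-term-non-adjacent {s} {x} {z} (_ , _ , _ , no-color-between) ¬adj with (s ≺? z) ×-dec (z ≺? x)
  ... | yes (s≺z , z≺x) =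
    non-adjacent-weight (no-color-between z s≺z z≺x) (λ adj → ¬adj (s≺z , z≺x , adj))
  ... | no _ = refl

  interval-term-bounds : ∀ {s x} → PrevOfColor s x → ∀ z →
                         0ℤ ≤ intervalTerm s x z × intervalTerm s x z ≤ 1ℤ
  interval-term-bounds {s} {x} s-prev z with adjInInterval? s x z
  ... | yes inside =
    subst (λ t → 0ℤ ≤ t × t ≤ 1ℤ) (sym (interval-term-adjacent inside)) (+≤+ z≤n , ℤ.≤-refl)
  ... | no outside =
    subst (λ t → 0ℤ ≤ t × t ≤ 1ℤ) (sym (interval-term-non-adjacent s-prev outside)) (ℤ.≤-refl , +≤+ z≤n)

  interval-at-most-two : ∀ {s x z₁ z₂ z₃} → PrevOfColor s x → z₁ ≢ z₂ → z₁ ≢ z₃ → z₂ ≢ z₃ →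
                         AdjInInterval s x z₁ → AdjInInterval s x z₂ → AdjInInterval s x z₃ → ⊥
  interval-at-most-two {s} {x} s-prev z₁≢z₂ z₁≢z₃ z₂≢z₃ in₁ in₂ in₃ =
    3≰2 (ℤ.≤-trans (3≤sum (proj₁ ∘ interval-term-bounds s-prev) z₁≢z₂ z₁≢z₃ z₂≢z₃
                          (one in₁) (one in₂) (one in₃))
                   (ℤ.≤-reflexive (interval-total s-prev)))
    where
      one : ∀ {z} → AdjInInterval s x z → 1ℤ ≤ intervalTerm s x z
      one inside = ℤ.≤-reflexive (sym (interval-term-adjacent inside))

  interval-pair-exhausts : ∀ {s x z₁ z₂ z} → PrevOfColor s x → z₁ ≢ z₂ →
                           AdjInInterval s x z₁ → AdjInInterval s x z₂ → AdjInInterval s x z →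
                           z ≡ z₁ ⊎ z ≡ z₂
  interval-pair-exhausts {z₁ = z₁} {z₂} {z} s-prev z₁≢z₂ in₁ in₂ in-z with z ≟ z₁ | z ≟ z₂
  ... | yes z≡z₁ | _        = inj₁ z≡z₁
  ... | no  _    | yes z≡z₂ = inj₂ z≡z₂
  ... | no  z≢z₁ | no  z≢z₂ =
    ⊥-elim (interval-at-most-two s-prev z₁≢z₂ (z≢z₁ ∘ sym) (z≢z₂ ∘ sym) in₁ in₂ in-z)

  interval-has-pair : ∀ {s x} → PrevOfColor s x →
                      ∃[ z₁ ] ∃[ z₂ ] (z₁ ≢ z₂ × AdjInInterval s x z₁ × AdjInInterval s x z₂)
  interval-has-pair {s} {x} s-prev with any? (adjInInterval? s x)
  ... | no none = ⊥-elim (2≰0 (ℤ.≤-trans (ℤ.≤-reflexive (sym (interval-total s-prev))) (sum-≤0 nothing)))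
    where
      nothing : ∀ z → intervalTerm s x z ≤ 0ℤ
      nothing z = ℤ.≤-reflexive (interval-term-non-adjacent s-prev (λ inside → none (z , inside)))
  ... | yes (z₁ , in₁) with any? (λ z → ¬? (z ≟ z₁) ×-dec adjInInterval? s x z)
  ...   | yes (z₂ , z₂≢z₁ , in₂) = z₁ , z₂ , z₂≢z₁ ∘ sym , in₁ , in₂
  ...   | no only-z₁ = ⊥-elim (2≰1 (ℤ.≤-trans (ℤ.≤-reflexive (sym (interval-total s-prev)))
                                              (sum-≤1 (proj₂ (interval-term-bounds s-prev z₁)) others)))
    where
      others : ∀ z → z ≢ z₁ → intervalTerm s x z ≤ 0ℤ
      others z z≢z₁ =
        ℤ.≤-reflexive (interval-term-non-adjacent s-prev (λ inside → only-z₁ (z , z≢z₁ , inside)))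

  covers⇒adjacent : ∀ {x y} → Covers P y x → Adj Γ (col y) (col x)
  covers⇒adjacent {x} {y} y-covers-x = Adj-sym Γ (NA x y y-covers-x)

  adjacent⇒≺⊎≻ : ∀ {x y} → Adj Γ (col x) (col y) → x ≺ y ⊎ y ≺ x
  adjacent⇒≺⊎≻ {x} {y} adj = comparable-≢ (AC x y adj) (adjacent-colors⇒≢ adj)

  cover-of-top-unique : ∀ {x p y} → InTop P x → Covers P p x → x ≺ y → Adj Γ (col y) (col x) → y ≡ p
  cover-of-top-unique x-top p-covers-x x≺y adj =
    upper-neighbour-unique x-top x≺y adj (proj₁ p-covers-x) (covers⇒adjacent p-covers-x)

  cover-of-top-below : ∀ {x p y} → InTop P x → Covers P p x → x ≺ y → p ≼ y
  cover-of-top-below x-top p-covers-x x≺y with cover-above x≺y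
  ... | z , z-covers-x , z≼y =
    subst (_≼ _) (cover-of-top-unique x-top p-covers-x (proj₁ z-covers-x) (covers⇒adjacent z-covers-x)) z≼y

  cover-of-top-InTop : ∀ {x p} → InTop P x → Covers P p x → InTop P p
  cover-of-top-InTop {x} x-top p-covers-x w w∈p p≺w =
    proj₂ p≺w (sym (cover-of-top-unique x-top p-covers-x (≺-trans (proj₁ p-covers-x) p≺w)
                                        (subst (λ c → Adj Γ c (col x)) (sym w∈p) (covers⇒adjacent p-covers-x))))

  adjacent-above-top-covers : ∀ {x y} → InTop P x → x ≺ y → Adj Γ (col y) (col x) → Covers P y x
  adjacent-above-top-covers x-top x≺y adj with cover-above x≺y
  ... | z , z-covers-x , _ =
    subst (λ w → Covers P w _) (sym (cover-of-top-unique x-top z-covers-x x≺y adj)) z-covers-x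

  InTop-upward-closed : ∀ {x y} → InTop P x → x ≼ y → InTop P y
  InTop-upward-closed x-top x≼y =
    ≼-by-covers (InTop P) (λ b-covers-a a-top → cover-of-top-InTop a-top b-covers-a) x≼y x-top

  -- Induct along the unique upper cover, which lies below everything above x.
  above-top-comparable : ∀ {x y z} → InTop P x → x ≺ y → x ≺ z → Comparable P y z
  above-top-comparable {x} = go (po-noetherian (isPO P) x)
    where
      go : ∀ {x y z} → Acc (flip _≺_) x → InTop P x → x ≺ y → x ≺ z → Comparable P y z
      go (acc rs) x-top x≺y x≺z with cover-above x≺y
      ... | p , p-covers-x , p≼y with cover-of-top-below x-top p-covers-x x≺z
      ...   | p≼z with ≼⇒≡⊎≺ p≼y | ≼⇒≡⊎≺ p≼z
      ...     | inj₁ refl | _         = inj₁ p≼z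
      ...     | inj₂ _    | inj₁ refl = inj₂ p≼y
      ...     | inj₂ p≺y  | inj₂ p≺z  =
        go (rs (proj₁ p-covers-x)) (cover-of-top-InTop x-top p-covers-x) p≺y p≺z

  -- Along a cover the colors are adjacent, so by (AC) the tops of the two colors are comparable;
  -- being below r then passes between them.
  InTop-below-maximal : Connected P → ∀ {r} → (∀ y → ¬ r ≺ y) → ∀ {x} → InTop P x → x ≼ r
  InTop-below-maximal connected {r} r-max {x} x-top =
    subst (_≼ r) (top-of-InTop x-top)
          (fold (λ a b → Below a → Below b) (λ a~b → _∘ Below-comparable a~b) id (connected r x) r-below)
    where
      Below : Fin n → Set
      Below z = top (col z) ≼ r

      r-below : Below r
      r-below = ≼-reflexive (top-of-InTop (maximal⇒InTop r-max))

      tops-transfer : ∀ {a b} → Comparable P (top a) (top b) → top a ≼ r → top b ≼ r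
      tops-transfer (inj₂ tb≼ta) ta≼r = ≼-trans tb≼ta ta≼r
      tops-transfer {a} {b} (inj₁ ta≼tb) ta≼r with ≼⇒≡⊎≺ ta≼tb
      ... | inj₁ ta≡tb = subst (_≼ r) ta≡tb ta≼r
      ... | inj₂ ta≺tb with ≼⇒≡⊎≺ ta≼r
      ...   | inj₁ ta≡r = ⊥-elim (r-max _ (subst (_≺ top b) ta≡r ta≺tb))
      ...   | inj₂ ta≺r with above-top-comparable (top-InTop a) ta≺tb ta≺r
      ...     | inj₁ tb≼r = tb≼r
      ...     | inj₂ r≼tb = ≼-reflexive (sym (maximal-≼⇒≡ r-max r≼tb))

      Below-cover : ∀ {a b} → Covers P b a → (Below a → Below b) × (Below b → Below a)
      Below-cover {a} {b} b-covers-a = tops-transfer comparable , tops-transfer (swap comparable)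
        where
          comparable : Comparable P (top (col a)) (top (col b))
          comparable = AC _ _ (subst₂ (Adj Γ) (sym (top-col _)) (sym (top-col _)) (NA a b b-covers-a))

      Below-comparable : ∀ {a b} → Comparable P a b → Below a → Below b
      Below-comparable (inj₁ a≼b) = ≼-by-covers Below (proj₁ ∘ Below-cover) a≼b
      Below-comparable {b = b} (inj₂ b≼a) =
        ≼-by-covers (λ c → Below c → Below b) (λ d-covers-c h → h ∘ proj₂ (Below-cover d-covers-c))
                    b≼a id

  covered⇒AdjInInterval : ∀ {s x w} → PrevOfColor s x → Covers P x w → AdjInInterval s x w
  covered⇒AdjInInterval {s} {x} {w} (s≺x , s∈x , _) x-covers-w
    with adjacent⇒≺⊎≻ {s} {w} (subst (λ c → Adj Γ c (col w)) (sym s∈x) (covers⇒adjacent x-covers-w))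
  ... | inj₁ s≺w = s≺w , proj₁ x-covers-w , NA w x x-covers-w
  ... | inj₂ w≺s = ⊥-elim (proj₂ x-covers-w s (w≺s , s≺x))

  prev-not-InTop : ∀ {s q} → PrevOfColor s q → ¬ InTop P s
  prev-not-InTop {q = q} (s≺q , s∈q , _) s-top = s-top q (sym s∈q) s≺q

module TopTreeFork {m n} {Γ : Dynkin m} (simply-laced : SimplyLaced Γ)
                   {P : ColoredPoset Γ n} (dc : DComplete P) (slant : SlantIrreducible P) where

  open DComplete dc
  open SimplyLacedDComplete simply-laced dc public

  CoversTwoTop : Fin n → Set
  CoversTwoTop t = ∃[ u ] ∃[ v ] (InTop P u × InTop P v × u ≢ v × Covers P t u × Covers P t v)

  CoversExactlyTwoTop : Fin n → Set
  CoversExactlyTwoTop t = ∃[ u ] ∃[ v ] (InTop P u × InTop P v × u ≢ v × Covers P t u × Covers P t v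
                                         × (∀ w → InTop P w → Covers P t w → w ≡ u ⊎ w ≡ v))

  prev-of-covering-top : ∀ {t u} → InTop P t → InTop P u → Covers P t u → ∃[ s ] PrevOfColor s t
  prev-of-covering-top t-top u-top t-covers-u with proj₂ slant _ _ u-top t-top t-covers-u
  ... | z , z≢t , z∈t with previous-of-color refl (≼-InTop t-top z∈t , z≢t) z∈t
  ...   | s , s-prev , _ = s , s-prev

  -- Invariant of the descent below the fork.
  record Pendant (x q s : Fin n) : Set where
    field
      x-top      : InTop P x
      q-covers-x : Covers P q x
      s-prev     : PrevOfColor s q
      x-alone    : ∀ z → AdjInInterval s q z → col z ≡ col x → z ≡ x

  module _ {x q s} (pendant : Pendant x q s) where
    open Pendant pendant

    private
      s∈q : col s ≡ col q
      s∈q = proj₁ (proj₂ s-prev)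

      x~q : Adj Γ (col x) (col q)
      x~q = NA x q q-covers-x

    pendant-prev : ∀ {e} → InTop P e → Covers P x e → ∃[ s′ ] (PrevOfColor s′ x × AdjInInterval s′ x s)
    pendant-prev e-top x-covers-e with prev-of-covering-top x-top e-top x-covers-e
    ... | s′ , s′-prev@(s′≺x , s′∈x , _) with adjacent⇒≺⊎≻ {s′} {s} (subst₂ (Adj Γ) (sym s′∈x) (sym s∈q) x~q)
    ...   | inj₁ s′≺s = s′ , s′-prev , s′≺s , proj₁ (covered⇒AdjInInterval s-prev q-covers-x) ,
                        subst (λ c → Adj Γ c (col x)) (sym s∈q) (Adj-sym Γ x~q)
    ...   | inj₂ s≺s′ = ⊥-elim (proj₂ s′≺x (x-alone s′ s′-inside s′∈x))
      where
        s′-inside : AdjInInterval s q s′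
        s′-inside = s≺s′ , ≺-trans s′≺x (proj₁ q-covers-x) , subst (λ c → Adj Γ c (col q)) (sym s′∈x) x~q

    top-≢-s : ∀ {e} → InTop P e → e ≢ s
    top-≢-s e-top refl = prev-not-InTop s-prev e-top

    pendant-unique-child : ∀ {e₁ e₂} → InTop P e₁ → InTop P e₂ → Covers P x e₁ → Covers P x e₂ → e₁ ≡ e₂
    pendant-unique-child {e₁} {e₂} e₁-top e₂-top x-covers-e₁ x-covers-e₂
      with pendant-prev e₁-top x-covers-e₁ | e₁ ≟ e₂
    ... | _ , _ , _ | yes e₁≡e₂ = e₁≡e₂
    ... | s′ , s′-prev , s-inside | no e₁≢e₂ =
      ⊥-elim (interval-at-most-two s′-prev e₁≢e₂ (top-≢-s e₁-top) (top-≢-s e₂-top)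
                (covered⇒AdjInInterval s′-prev x-covers-e₁) (covered⇒AdjInInterval s′-prev x-covers-e₂) s-inside)

    pendant-step : ∀ {e} → InTop P e → Covers P x e → ∃[ s′ ] Pendant e x s′
    pendant-step {e} e-top x-covers-e with pendant-prev e-top x-covers-e
    ... | s′ , s′-prev , s-inside = s′ , record
      { x-top = e-top ; q-covers-x = x-covers-e ; s-prev = s′-prev ; x-alone = alone }
      where
        alone : ∀ z → AdjInInterval s′ x z → col z ≡ col e → z ≡ e
        alone z z-inside z∈e with interval-pair-exhausts s′-prev (top-≢-s e-top)
                                    (covered⇒AdjInInterval s′-prev x-covers-e) s-inside z-inside
        ... | inj₁ z≡e  = z≡e
        ... | inj₂ refl = ⊥-elim (e-top q (trans (sym s∈q) z∈e) (≺-trans (proj₁ x-covers-e) (proj₁ q-covers-x)))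

  pendant-no-fork-below : ∀ {x q s} → Pendant x q s → ∀ {y} → InTop P y → y ≼ x → ¬ CoversTwoTop y
  pendant-no-fork-below {x} = go (po-wellFounded (isPO P) x)
    where
      go : ∀ {x q s} → Acc _≺_ x → Pendant x q s → ∀ {y} → InTop P y → y ≼ x → ¬ CoversTwoTop y
      go (acc rs) pendant y-top y≼x fork@(u , v , u-top , v-top , u≢v , y-covers-u , y-covers-v)
        with ≼⇒≡⊎≺ y≼x
      ... | inj₁ refl = u≢v (pendant-unique-child pendant u-top v-top y-covers-u y-covers-v)
      ... | inj₂ y≺x with cover-below y≺x
      ...   | w , y≼w , x-covers-w with pendant-step pendant (InTop-upward-closed y-top y≼w) x-covers-w
      ...     | _ , pendant′ = go (rs (proj₁ x-covers-w)) pendant′ y-top y≼w fork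

  -- Invariant of the descent above the fork; nothing-above keeps the top of the color of each
  -- adjacent-colored element of (s, x) inside (s, x).
  record Anchor (x s : Fin n) : Set where
    field
      x-top         : InTop P x
      s-prev        : PrevOfColor s x
      nothing-above : ∀ {z w} → AdjInInterval s x z → col w ≡ col z → ¬ x ≺ w

  ForkBelow : Fin n → Set
  ForkBelow x = ∃[ b ] (InTop P b × CoversExactlyTwoTop b × b ≼ x
                        × ∀ y → InTop P y → y ≼ x → Comparable P b y × (CoversTwoTop y → y ≡ b))

  module _ {x s} (anchor : Anchor x s) where
    open Anchor anchor

    top-inside : ∀ {z} → AdjInInterval s x z → AdjInInterval s x (top (col z)) × z ≼ top (col z)
    top-inside {z} z-inside@(s≺z , _ , z~x) with adjacent⇒≺⊎≻ (top-Adj z~x)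
    ... | inj₁ t≺x = (≺-≼-trans s≺z z≼t , t≺x , top-Adj z~x) , z≼t
      where
        z≼t : z ≼ top (col z)
        z≼t = ≼-InTop (top-InTop _) (sym (top-col _))
    ... | inj₂ x≺t = ⊥-elim (nothing-above z-inside (top-col _) x≺t)

    top-or-below-partner : ∀ {z₁ z₂} → z₁ ≢ z₂ → AdjInInterval s x z₁ → AdjInInterval s x z₂ →
                           InTop P z₁ ⊎ (InTop P z₂ × z₁ ≺ z₂ × col z₂ ≡ col z₁)
    top-or-below-partner {z₁} z₁≢z₂ in₁ in₂ with top-inside in₁ | z₁ ≟ top (col z₁)
    ... | _ | yes z₁≡t = inj₁ (subst (InTop P) (sym z₁≡t) (top-InTop _))
    ... | t-inside , z₁≼t | no z₁≢t with interval-pair-exhausts s-prev z₁≢z₂ in₁ in₂ t-inside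
    ...   | inj₁ t≡z₁ = ⊥-elim (z₁≢t (sym t≡z₁))
    ...   | inj₂ refl = inj₂ (top-InTop _ , (z₁≼t , z₁≢t) , top-col _)

    fork-at : ∀ {z₁ z₂} → z₁ ≢ z₂ → AdjInInterval s x z₁ → AdjInInterval s x z₂ →
              InTop P z₁ → InTop P z₂ → ForkBelow x
    fork-at {z₁} {z₂} z₁≢z₂ in₁ in₂ z₁-top z₂-top =
      x , x-top , (z₁ , z₂ , z₁-top , z₂-top , z₁≢z₂ , covers in₁ z₁-top , covers in₂ z₂-top , exhausts) ,
      ≼-refl , below
      where
        covers : ∀ {z} → AdjInInterval s x z → InTop P z → Covers P x z
        covers (_ , z≺x , z~x) z-top = adjacent-above-top-covers z-top z≺x (Adj-sym Γ z~x)

        pair-exhausts : ∀ {z} → AdjInInterval s x z → z ≡ z₁ ⊎ z ≡ z₂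
        pair-exhausts = interval-pair-exhausts s-prev z₁≢z₂ in₁ in₂

        exhausts : ∀ w → InTop P w → Covers P x w → w ≡ z₁ ⊎ w ≡ z₂
        exhausts w _ x-covers-w = pair-exhausts (covered⇒AdjInInterval s-prev x-covers-w)

        top-of-pair : ∀ {z} → z ≡ z₁ ⊎ z ≡ z₂ → InTop P z
        top-of-pair (inj₁ refl) = z₁-top
        top-of-pair (inj₂ refl) = z₂-top

        child-pendant : ∀ {w} → InTop P w → Covers P x w → Pendant w x s
        child-pendant w-top x-covers-w = record
          { x-top = w-top ; q-covers-x = x-covers-w ; s-prev = s-prev
          ; x-alone = λ z z-inside → InTop-unique (top-of-pair (pair-exhausts z-inside)) w-top }

        below : ∀ y → InTop P y → y ≼ x → Comparable P x y × (CoversTwoTop y → y ≡ x)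
        below y y-top y≼x with ≼⇒≡⊎≺ y≼x
        ... | inj₁ refl = inj₁ ≼-refl , λ _ → refl
        ... | inj₂ y≺x with cover-below y≺x
        ...   | w , y≼w , x-covers-w =
          inj₂ y≼x , ⊥-elim ∘ pendant-no-fork-below pendant y-top y≼w
          where
            pendant : Pendant w x s
            pendant = child-pendant (InTop-upward-closed y-top y≼w) x-covers-w

    fork-via-child : (∀ {a s′} → a ≺ x → Anchor a s′ → ForkBelow a) →
                     ∀ {z a} → AdjInInterval s x z → AdjInInterval s x a →
                     (∀ {w} → AdjInInterval s x w → w ≡ z ⊎ w ≡ a) →
                     InTop P a → z ≺ a → col a ≡ col z → ForkBelow x
    fork-via-child fork-below-child {z} {a} (s≺z , _ , _) (_ , a≺x , a~x) exhausts a-top z≺a a∈z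
      with previous-of-color refl z≺a (sym a∈z)
    ... | sa , sa-prev , z≼sa
      with fork-below-child a≺x (record { x-top = a-top ; s-prev = sa-prev ; nothing-above = x-only-above })
      where
        -- The only element above a of color adjacent to col a is x, and col x does not occur in (s, x).
        x-only-above : ∀ {z′ w} → AdjInInterval sa a z′ → col w ≡ col z′ → ¬ a ≺ w
        x-only-above {z′} {w} (sa≺z′ , z′≺a , z′~a) w∈z′ a≺w = no-color-between z′ s≺z′ (≺-trans z′≺a a≺x) z′∈x
          where
            no-color-between : ∀ y → s ≺ y → y ≺ x → col y ≢ col x
            no-color-between = proj₂ (proj₂ (proj₂ s-prev))

            s≺z′ : s ≺ z′
            s≺z′ = ≺-trans s≺z (≼-≺-trans z≼sa sa≺z′)

            w≡x : w ≡ x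
            w≡x = upper-neighbour-unique a-top a≺w (subst (λ c → Adj Γ c (col a)) (sym w∈z′) z′~a)
                                         a≺x (Adj-sym Γ a~x)

            z′∈x : col z′ ≡ col x
            z′∈x = trans (sym w∈z′) (cong col w≡x)
    ... | b , b-top , b-fork , b≼a , below-a = b , b-top , b-fork , ≼-trans b≼a (proj₁ a≺x) , below
      where
        only-child : ∀ {w} → InTop P w → Covers P x w → w ≡ a
        only-child w-top x-covers-w with exhausts (covered⇒AdjInInterval s-prev x-covers-w)
        ... | inj₁ refl = ⊥-elim (w-top a a∈z z≺a)
        ... | inj₂ w≡a  = w≡a

        below : ∀ y → InTop P y → y ≼ x → Comparable P b y × (CoversTwoTop y → y ≡ b)
        below y y-top y≼x with ≼⇒≡⊎≺ y≼x
        ... | inj₁ refl = inj₁ (≼-trans b≼a (proj₁ a≺x)) ,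
                          λ (u , v , u-top , v-top , u≢v , y-covers-u , y-covers-v) →
                            ⊥-elim (u≢v (trans (only-child u-top y-covers-u) (sym (only-child v-top y-covers-v))))
        ... | inj₂ y≺x with cover-below y≺x
        ...   | w , y≼w , x-covers-w =
          below-a y y-top (subst (y ≼_) (only-child (InTop-upward-closed y-top y≼w) x-covers-w) y≼w)

  fork-below : ∀ {x s} → Anchor x s → ForkBelow x
  fork-below {x} = go (po-wellFounded (isPO P) x)
    where
      go : ∀ {x s} → Acc _≺_ x → Anchor x s → ForkBelow x
      go {x} {s} (acc rs) anchor with interval-has-pair (Anchor.s-prev anchor)
      ... | z₁ , z₂ , z₁≢z₂ , in₁ , in₂
        with top-or-below-partner anchor z₁≢z₂ in₁ in₂ | top-or-below-partner anchor (z₁≢z₂ ∘ sym) in₂ in₁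
      ...   | inj₁ z₁-top | inj₁ z₂-top = fork-at anchor z₁≢z₂ in₁ in₂ z₁-top z₂-top
      ...   | inj₂ (z₂-top , z₁≺z₂ , z₂∈z₁) | _ =
        fork-via-child anchor (go ∘ rs) in₁ in₂ exhausts z₂-top z₁≺z₂ z₂∈z₁
        where
          exhausts : ∀ {w} → AdjInInterval s x w → w ≡ z₁ ⊎ w ≡ z₂
          exhausts = interval-pair-exhausts (Anchor.s-prev anchor) z₁≢z₂ in₁ in₂
      ...   | inj₁ _ | inj₂ (z₁-top , z₂≺z₁ , z₁∈z₂) =
        fork-via-child anchor (go ∘ rs) in₂ in₁ (swap ∘ exhausts) z₁-top z₂≺z₁ z₁∈z₂
        where
          exhausts : ∀ {w} → AdjInInterval s x w → w ≡ z₁ ⊎ w ≡ z₂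
          exhausts = interval-pair-exhausts (Anchor.s-prev anchor) z₁≢z₂ in₁ in₂

  another-top : ∀ {x y} → InTop P x → InTop P y → x ≢ y → ∀ r → ∃[ c ] (InTop P c × c ≢ r)
  another-top {x} x-top y-top x≢y r with x ≟ r
  ... | no  x≢r  = x , x-top , x≢r
  ... | yes refl = _ , y-top , x≢y ∘ sym

  top-tree-fork : (∃[ x ] ∃[ y ] (InTop P x × InTop P y × x ≢ y)) →
                  ∃[ b ] (InTop P b × CoversExactlyTwoTop b × (∀ t → InTop P t → Comparable P b t)
                          × (∀ t → InTop P t → CoversTwoTop t → t ≡ b))
  top-tree-fork (x , y , x-top , y-top , x≢y) with maximal-element x
  ... | r , r-max with another-top x-top y-top x≢y r
  ...   | c , c-top , c≢r with cover-below (InTop-below-maximal (proj₁ slant) r-max c-top , c≢r)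
  ...     | w , c≼w , r-covers-w
    with prev-of-covering-top (maximal⇒InTop r-max) (InTop-upward-closed c-top c≼w) r-covers-w
  ...       | s , s-prev
    with fork-below (record { x-top = maximal⇒InTop r-max ; s-prev = s-prev ; nothing-above = λ _ _ → r-max _ })
  ...         | b , b-top , b-fork , _ , below-r =
    b , b-top , b-fork , (λ t → proj₁ ∘ below t) , (λ t → proj₂ ∘ below t)
    where
      below : ∀ t → InTop P t → Comparable P b t × (CoversTwoTop t → t ≡ b)
      below t t-top = below-r t t-top (InTop-below-maximal (proj₁ slant) r-max t-top)

proposition5p4 : ∀ {m n : ℕ} (Γ : Dynkin m) → SimplyLaced Γ →
    (P : ColoredPoset Γ n) → DComplete P → SlantIrreducible P →
    (∃[ x ] ∃[ y ] (InTop P x × InTop P y × x ≢ y)) →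
    ∃[ t ] (InTop P t
      × (∃[ u ] ∃[ v ] (InTop P u × InTop P v × u ≢ v × Covers P t u × Covers P t v
           × (∀ w → InTop P w → Covers P t w → w ≡ u ⊎ w ≡ v)))
      × (∀ s → InTop P s → Comparable P t s)
      × (∀ t′ → InTop P t′ →
           (∃[ u ] ∃[ v ] (InTop P u × InTop P v × u ≢ v × Covers P t′ u × Covers P t′ v)) →
           t′ ≡ t))
proposition5p4 Γ simply-laced P dc slant = TopTreeFork.top-tree-fork simply-laced dc slant
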